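{- Let $k\ge 4$, $n\ge 1$, and let $G$ be a $C_4$-saturated spanning subgraph of $K_k^n$. If $\delta(G)=2$ and some vertex of degree $2$ in $G$ does not lie in a triangle of $G$, then $e(G) \geq \frac{(3k-1)n-4}{2}$.
   Context: All graphs are finite, simple and undirected. $K_k^n$ denotes the complete $k$-partite graph with exactly $n$ vertices in each of its $k$ parts. $C_4$ is the cycle on $4$ vertices. A spanning subgraph $H$ of $K_k^n$ is $C_4$-saturated (relative to $K_k^n$) if $H$ contains no $C_4$ but $H+e$ contains a $C_4$ for every $e\in E(K_k^n)\setminus E(H)$. $\delta(G)$ is the minimum degree and $e(G)$ the number of edges. -}

module Defs where

open import Data.Nat using (ℕ; _+_; _*_; _<_; _≤_)
open import Data.Fin using (Fin; toℕ)
open import Data.Fin.Properties using (_≟_)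
open import Data.Bool using (Bool; true; false; _∨_; _∧_; if_then_else_)
open import Data.Product using (_×_; _,_; proj₁; proj₂; ∃-syntax; Σ-syntax)
open import Data.List using (List; length; filter; map; cartesianProduct)
open import Data.List using (allFin)
open import Relation.Nullary using (¬_; Dec; does)
open import Relation.Nullary.Decidable using (⌊_⌋)
open import Relation.Binary.PropositionalEquality using (_≡_; _≢_)
open import Data.Nat.Properties using (_<?_)
import Data.Nat.Properties as ℕP

-- Vertices of K_k^n: pairs (part, index within part).
Vertex : ℕ → ℕ → Set
Vertex k n = Fin k × Fin n

vertices : (k n : ℕ) → List (Vertex k n)
vertices k n = cartesianProduct (allFin k) (allFin n)

DiffPart : {k n : ℕ} → Vertex k n → Vertex k n → Set
DiffPart u v = proj₁ u ≢ proj₁ v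

record Subgraph (k n : ℕ) : Set where
  field
    adj     : Vertex k n → Vertex k n → Bool
    sym     : ∀ u v → adj u v ≡ adj v u
    inHost  : ∀ u v → adj u v ≡ true → DiffPart u v
open Subgraph public

Adj : {k n : ℕ} → Subgraph k n → Vertex k n → Vertex k n → Set
Adj G u v = adj G u v ≡ true

degree : {k n : ℕ} → Subgraph k n → Vertex k n → ℕ
degree {k} {n} G v = length (filter (λ u → Data.Bool._≟_ (adj G v u) true) (vertices k n))

-- Linear index of a vertex, used to count each edge once.
index : {k n : ℕ} → Vertex k n → ℕ
index {k} {n} (i , j) = toℕ i * n + toℕ j

edgeCount : {k n : ℕ} → Subgraph k n → ℕ
edgeCount {k} {n} G =
  length (filter (λ p → Data.Bool._≟_ (adj G (proj₁ p) (proj₂ p) ∧ ⌊ index (proj₁ p) <? index (proj₂ p) ⌋) true)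
                 (cartesianProduct (vertices k n) (vertices k n)))

MinDegree : {k n : ℕ} → Subgraph k n → ℕ → Set
MinDegree {k} {n} G d = (∃[ v ] degree G v ≡ d) × (∀ v → d ≤ degree G v)

HasC4 : {V : Set} → (V → V → Set) → Set
HasC4 {V} R = ∃[ a ] ∃[ b ] ∃[ c ] ∃[ d ]
  ((a ≢ b) × (a ≢ c) × (a ≢ d) × (b ≢ c) × (b ≢ d) × (c ≢ d)) ×
  (R a b × R b c × R c d × R d a)

AdjPlus : {k n : ℕ} → Subgraph k n → Vertex k n → Vertex k n →
          Vertex k n → Vertex k n → Set
AdjPlus G u v x y = Adj G x y Data.Sum.⊎ ((x ≡ u × y ≡ v) Data.Sum.⊎ (x ≡ v × y ≡ u))
  where import Data.Sum

C4Saturated : {k n : ℕ} → Subgraph k n → Set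
C4Saturated G =
  ¬ HasC4 (Adj G) ×
  (∀ u v → DiffPart u v → ¬ Adj G u v → HasC4 (AdjPlus G u v))

InTriangle : {k n : ℕ} → Subgraph k n → Vertex k n → Set
InTriangle G v = ∃[ a ] ∃[ b ] (Adj G v a × Adj G a b × Adj G b v)

-- Let v be a vertex of degree 2 with non-adjacent neighbours a and b. Put v, a, b on
-- level 0, the other neighbours of a or b on level 1 and all remaining vertices on
-- level 2. Every edge carries two units of charge: an edge inside a level gives one
-- unit to each end, any other edge gives both units to its end on the higher level.
-- The total charge is 2e(G). Add one extra unit on every vertex of the part of v and
-- two on each of a and b, n + 4 units in all. Every vertex now holds at least 3 units.
-- This is immediate for v, a, b; a level-1 vertex gets 2 units from its edge to a or b,
-- and a level-2 vertex gets one unit per edge, hence 2 as δ(G) = 2. The missing unit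
-- comes for free in the part of v; any other x is not adjacent to v, so saturation puts
-- a path x y z v into G, whence z ∈ {a, b} and y lies on level 1, sending x another
-- unit. Hence 3kn ≤ 2e(G) + n + 4.
module Submission where

open import Defs
open import Data.Nat using (ℕ; zero; suc; _+_; _*_; _∸_; _≤_; z≤n; s≤s)
open import Data.Nat.Properties
open import Algebra.Properties.CommutativeSemigroup +-commutativeSemigroup using (interchange)
open import Data.Bool using (true; false; _∧_) renaming (_≟_ to _≟ᵇ_)
open import Data.Fin using (Fin; toℕ; combine) renaming (_<_ to _<ᶠ_)
import Data.Fin.Properties as Fin
open import Data.Product using (_×_; _,_; proj₁; proj₂; ∃-syntax)
open import Data.Product.Properties using (≡-dec)
open import Data.Sum using (_⊎_; inj₁; inj₂)
open import Data.Empty using (⊥; ⊥-elim)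
open import Data.List using (List; []; _∷_; _++_; map; length; filter; cartesianProduct; allFin)
open import Data.List.Properties using (length-tabulate)
open import Data.List.Membership.Propositional using (_∈_)
open import Data.List.Membership.Propositional.Properties
  using (∈-allFin; ∈-cartesianProduct⁺; ∈-filter⁺; ∈-filter⁻)
open import Data.List.Relation.Unary.Any using (here; there)
open import Data.List.Relation.Unary.All as All using (All; []; _∷_)
open import Data.List.Relation.Unary.AllPairs using ([]; _∷_)
open import Data.List.Relation.Unary.Unique.Propositional using (Unique)
open import Data.List.Relation.Unary.Unique.Propositional.Properties
  using (allFin⁺; cartesianProduct⁺; filter⁺)
open import Relation.Nullary using (¬_; Dec; yes; no)
open import Relation.Nullary.Decidable using (⌊_⌋; _⊎-dec_)
open import Relation.Unary using (Pred; Decidable)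
open import Relation.Binary using (DecidableEquality; Tri; tri<; tri≈; tri>)
open import Relation.Binary.PropositionalEquality
  using (_≡_; _≢_; refl; trans; cong; cong₂; subst; ≢-sym; module ≡-Reasoning)
import Relation.Binary.PropositionalEquality as ≡
open import Function using (_∘_)

∑ : {A : Set} → List A → (A → ℕ) → ℕ
∑ []       f = 0
∑ (x ∷ xs) f = f x + ∑ xs f

syntax ∑ xs (λ x → e) = ∑[ x ∈ xs ] e

𝟙 : {P : Set} → Dec P → ℕ
𝟙 (yes _) = 1
𝟙 (no _)  = 0

𝟙-yes : {P : Set} (P? : Dec P) → P → 𝟙 P? ≡ 1
𝟙-yes (yes _) _ = refl
𝟙-yes (no ¬p) p = ⊥-elim (¬p p)

𝟙-no : {P : Set} (P? : Dec P) → ¬ P → 𝟙 P? ≡ 0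
𝟙-no (yes p) ¬p = ⊥-elim (¬p p)
𝟙-no (no _)  _  = refl

module _ {A : Set} where

  ∑-cong : (xs : List A) {f g : A → ℕ} → (∀ x → f x ≡ g x) → ∑ xs f ≡ ∑ xs g
  ∑-cong []       f≡g = refl
  ∑-cong (x ∷ xs) f≡g = cong₂ _+_ (f≡g x) (∑-cong xs f≡g)

  ∑-mono : (xs : List A) {f g : A → ℕ} → (∀ x → f x ≤ g x) → ∑ xs f ≤ ∑ xs g
  ∑-mono []       f≤g = z≤n
  ∑-mono (x ∷ xs) f≤g = +-mono-≤ (f≤g x) (∑-mono xs f≤g)

  ∑-+ : (xs : List A) (f g : A → ℕ) → ∑[ x ∈ xs ] (f x + g x) ≡ ∑ xs f + ∑ xs g
  ∑-+ []       f g = refl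
  ∑-+ (x ∷ xs) f g = trans (cong (f x + g x +_) (∑-+ xs f g)) (interchange (f x) (g x) _ _)

  *-distribˡ-∑ : (c : ℕ) (xs : List A) (f : A → ℕ) → c * ∑ xs f ≡ ∑[ x ∈ xs ] (c * f x)
  *-distribˡ-∑ c []       f = *-zeroʳ c
  *-distribˡ-∑ c (x ∷ xs) f = trans (*-distribˡ-+ c (f x) (∑ xs f)) (cong (c * f x +_) (*-distribˡ-∑ c xs f))

  ∑-const : (xs : List A) (c : ℕ) → ∑[ _ ∈ xs ] c ≡ length xs * c
  ∑-const []       c = refl
  ∑-const (x ∷ xs) c = cong (c +_) (∑-const xs c)

  ∑-zero : (xs : List A) {f : A → ℕ} → All (λ x → f x ≡ 0) xs → ∑ xs f ≡ 0
  ∑-zero []       []           = refl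
  ∑-zero (x ∷ xs) (fx≡0 ∷ f≡0) = cong₂ _+_ fx≡0 (∑-zero xs f≡0)

  ∑-++ : (xs ys : List A) (f : A → ℕ) → ∑ (xs ++ ys) f ≡ ∑ xs f + ∑ ys f
  ∑-++ []       ys f = refl
  ∑-++ (x ∷ xs) ys f = trans (cong (f x +_) (∑-++ xs ys f)) (≡.sym (+-assoc (f x) _ _))

  length-filter : {P : Pred A _} (P? : Decidable P) (xs : List A) →
                  length (filter P? xs) ≡ ∑[ x ∈ xs ] 𝟙 (P? x)
  length-filter P? []       = refl
  length-filter P? (x ∷ xs) with P? x
  ... | yes _ = cong suc (length-filter P? xs)
  ... | no _  = length-filter P? xs

  term≤∑ : {xs : List A} {t : A} (f : A → ℕ) → t ∈ xs → f t ≤ ∑ xs f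
  term≤∑ f (here refl) = m≤m+n _ _
  term≤∑ {x ∷ _} f (there t∈xs) = ≤-trans (term≤∑ f t∈xs) (m≤n+m _ (f x))

  two-terms≤∑ : {xs : List A} {s t : A} (f : A → ℕ) → s ≢ t → s ∈ xs → t ∈ xs → f s + f t ≤ ∑ xs f
  two-terms≤∑ f s≢t (here refl) (here refl) = ⊥-elim (s≢t refl)
  two-terms≤∑ f s≢t (here refl) (there t∈xs) = +-monoʳ-≤ (f _) (term≤∑ f t∈xs)
  two-terms≤∑ {x ∷ xs} f s≢t (there s∈xs) (here refl) =
    subst (_≤ f x + ∑ xs f) (+-comm (f x) _) (+-monoʳ-≤ (f x) (term≤∑ f s∈xs))
  two-terms≤∑ {x ∷ _} f s≢t (there s∈xs) (there t∈xs) =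
    ≤-trans (two-terms≤∑ f s≢t s∈xs t∈xs) (m≤n+m _ (f x))

  ∑-mono-+ : {xs : List A} {t : A} {f g : A → ℕ} (m : ℕ) → t ∈ xs →
             (∀ x → g x ≤ f x) → g t + m ≤ f t → ∑ xs g + m ≤ ∑ xs f
  ∑-mono-+ {_ ∷ xs} {t} {f} {g} m (here refl) g≤f gt+m≤ft = begin
    g t + ∑ xs g + m   ≡⟨ +-assoc (g t) _ m ⟩
    g t + (∑ xs g + m) ≡⟨ cong (g t +_) (+-comm _ m) ⟩
    g t + (m + ∑ xs g) ≡⟨ ≡.sym (+-assoc (g t) m _) ⟩
    g t + m + ∑ xs g   ≤⟨ +-mono-≤ gt+m≤ft (∑-mono xs g≤f) ⟩
    f t + ∑ xs f       ∎
    where open ≤-Reasoning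
  ∑-mono-+ {x ∷ xs} {f = f} {g} m (there t∈xs) g≤f gt+m≤ft = begin
    g x + ∑ xs g + m   ≡⟨ +-assoc (g x) _ m ⟩
    g x + (∑ xs g + m) ≤⟨ +-mono-≤ (g≤f x) (∑-mono-+ m t∈xs g≤f gt+m≤ft) ⟩
    f x + ∑ xs f       ∎
    where open ≤-Reasoning

  module _ (_≟_ : DecidableEquality A) where

    ∑-𝟙-unique : {xs : List A} {t : A} → Unique xs → t ∈ xs → ∑[ x ∈ xs ] 𝟙 (x ≟ t) ≡ 1
    ∑-𝟙-unique {x ∷ xs} (x∉xs ∷ _) (here refl) =
      cong₂ _+_ (𝟙-yes (x ≟ x) refl) (∑-zero xs (All.map (λ {y} x≢y → 𝟙-no (y ≟ x) (≢-sym x≢y)) x∉xs))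
    ∑-𝟙-unique {x ∷ xs} {t} (x∉xs ∷ xs!) (there t∈xs) =
      cong₂ _+_ (𝟙-no (x ≟ t) (All.lookup x∉xs t∈xs)) (∑-𝟙-unique xs! t∈xs)

∑-map : {A B : Set} (xs : List A) (h : A → B) (f : B → ℕ) → ∑ (map h xs) f ≡ ∑ xs (f ∘ h)
∑-map []       h f = refl
∑-map (x ∷ xs) h f = cong (f (h x) +_) (∑-map xs h f)

∑-cartesianProduct : {A B : Set} (xs : List A) (ys : List B) (f : A × B → ℕ) →
                     ∑ (cartesianProduct xs ys) f ≡ ∑[ x ∈ xs ] ∑[ y ∈ ys ] f (x , y)
∑-cartesianProduct []       ys f = refl
∑-cartesianProduct (x ∷ xs) ys f =
  trans (∑-++ (map (x ,_) ys) _ f) (cong₂ _+_ (∑-map ys (x ,_) f) (∑-cartesianProduct xs ys f))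

∑-comm : {A B : Set} (xs : List A) (ys : List B) (f : A → B → ℕ) →
         ∑[ x ∈ xs ] ∑[ y ∈ ys ] f x y ≡ ∑[ y ∈ ys ] ∑[ x ∈ xs ] f x y
∑-comm []       ys f = ≡.sym (trans (∑-const ys 0) (*-zeroʳ (length ys)))
∑-comm (x ∷ xs) ys f =
  trans (cong (∑ ys (f x) +_) (∑-comm xs ys f)) (≡.sym (∑-+ ys (f x) (λ y → ∑[ x′ ∈ xs ] f x′ y)))

∑-share : {A : Set} (xs : List A) (w s : A → A → ℕ) →
          (∀ x y → w x y ≡ w y x) → (∀ x y → s x y + s y x ≡ 2) →
          ∑[ x ∈ xs ] ∑[ y ∈ xs ] (w x y * s x y) ≡ ∑[ x ∈ xs ] ∑[ y ∈ xs ] w x y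
∑-share xs w s w-sym s-split = *-cancelˡ-≡ _ _ 2 (begin
  2 * S                                                     ≡⟨ cong (S +_) (+-identityʳ S) ⟩
  S + S                                                     ≡⟨ cong (S +_) S≡S′ ⟩
  S + S′                                                    ≡⟨ ≡.sym (∑-+ xs _ _) ⟩
  ∑[ x ∈ xs ] (∑[ y ∈ xs ] (w x y * s x y) + ∑[ y ∈ xs ] (w x y * s y x))
                                                            ≡⟨ ∑-cong xs (λ x → ≡.sym (∑-+ xs _ _)) ⟩
  ∑[ x ∈ xs ] ∑[ y ∈ xs ] (w x y * s x y + w x y * s y x)   ≡⟨ ∑-cong xs (λ x → ∑-cong xs (λ y → split x y)) ⟩
  ∑[ x ∈ xs ] ∑[ y ∈ xs ] (2 * w x y)                       ≡⟨ ∑-cong xs (λ x → ≡.sym (*-distribˡ-∑ 2 xs (w x))) ⟩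
  ∑[ x ∈ xs ] (2 * ∑[ y ∈ xs ] w x y)                       ≡⟨ ≡.sym (*-distribˡ-∑ 2 xs _) ⟩
  2 * ∑[ x ∈ xs ] ∑[ y ∈ xs ] w x y                         ∎)
  where
  open ≡-Reasoning
  S S′ : ℕ
  S  = ∑[ x ∈ xs ] ∑[ y ∈ xs ] (w x y * s x y)
  S′ = ∑[ x ∈ xs ] ∑[ y ∈ xs ] (w x y * s y x)
  S≡S′ : S ≡ S′
  S≡S′ = trans (∑-comm xs xs (λ x y → w x y * s x y))
               (∑-cong xs (λ x → ∑-cong xs (λ y → cong (_* s y x) (w-sym y x))))
  split : ∀ x y → w x y * s x y + w x y * s y x ≡ 2 * w x y
  split x y = trans (≡.sym (*-distribˡ-+ (w x y) _ _))
                    (trans (cong (w x y *_) (s-split x y)) (*-comm (w x y) 2))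

length-allFin : (n : ℕ) → length (allFin n) ≡ n
length-allFin n = length-tabulate {n = n} (λ i → i)

module _ {k n : ℕ} where

  _≟ᵥ_ : DecidableEquality (Vertex k n)
  _≟ᵥ_ = ≡-dec Fin._≟_ Fin._≟_

  ∈-vertices : (x : Vertex k n) → x ∈ vertices k n
  ∈-vertices (i , j) = ∈-cartesianProduct⁺ (∈-allFin i) (∈-allFin j)

  vertices-unique : Unique (vertices k n)
  vertices-unique = cartesianProduct⁺ (allFin⁺ k) (allFin⁺ n)

  ∑-vertices-const : (c : ℕ) → ∑[ _ ∈ vertices k n ] c ≡ k * (n * c)
  ∑-vertices-const c = begin
    ∑[ _ ∈ vertices k n ] c                    ≡⟨ ∑-cartesianProduct (allFin k) (allFin n) _ ⟩
    ∑[ _ ∈ allFin k ] ∑[ _ ∈ allFin n ] c       ≡⟨ ∑-cong (allFin k) (λ _ → ∑-const (allFin n) c) ⟩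
    ∑[ _ ∈ allFin k ] (length (allFin n) * c)   ≡⟨ ∑-const (allFin k) _ ⟩
    length (allFin k) * (length (allFin n) * c) ≡⟨ cong₂ (λ p q → p * (q * c)) (length-allFin k) (length-allFin n) ⟩
    k * (n * c)                                 ∎
    where open ≡-Reasoning

  part-size : (i : Fin k) → ∑[ x ∈ vertices k n ] 𝟙 (proj₁ x Fin.≟ i) ≡ n
  part-size i = begin
    ∑[ x ∈ vertices k n ] 𝟙 (proj₁ x Fin.≟ i)       ≡⟨ ∑-cartesianProduct (allFin k) (allFin n) _ ⟩
    ∑[ i′ ∈ allFin k ] ∑[ _ ∈ allFin n ] 𝟙 (i′ Fin.≟ i) ≡⟨ ∑-cong (allFin k) (λ i′ → ∑-const (allFin n) _) ⟩
    ∑[ i′ ∈ allFin k ] (length (allFin n) * 𝟙 (i′ Fin.≟ i)) ≡⟨ ≡.sym (*-distribˡ-∑ (length (allFin n)) (allFin k) (λ i′ → 𝟙 (i′ Fin.≟ i))) ⟩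
    length (allFin n) * ∑[ i′ ∈ allFin k ] 𝟙 (i′ Fin.≟ i) ≡⟨ cong₂ _*_ (length-allFin n) (∑-𝟙-unique Fin._≟_ (allFin⁺ k) (∈-allFin i)) ⟩
    n * 1                                           ≡⟨ *-identityʳ n ⟩
    n                                               ∎
    where open ≡-Reasoning

  index≡combine : (x : Vertex k n) → index x ≡ toℕ (combine (proj₁ x) (proj₂ x))
  index≡combine (i , j) = trans (cong (_+ toℕ j) (*-comm (toℕ i) n)) (≡.sym (Fin.toℕ-combine i j))

  DiffPart⇒index≢ : {x y : Vertex k n} → DiffPart x y → index x ≢ index y
  DiffPart⇒index≢ {i , j} {i′ , j′} i≢i′ eq = contradiction (Fin.<-cmp i i′)
    where
    combine-eq : toℕ (combine i j) ≡ toℕ (combine i′ j′)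
    combine-eq = trans (≡.sym (index≡combine (i , j))) (trans eq (index≡combine (i′ , j′)))
    contradiction : Tri (i <ᶠ i′) (i ≡ i′) (i′ <ᶠ i) → ⊥
    contradiction (tri< i<i′ _ _) = <-irrefl combine-eq (Fin.combine-monoˡ-< j j′ i<i′)
    contradiction (tri≈ _ i≡i′ _) = i≢i′ i≡i′
    contradiction (tri> _ _ i′<i) = <-irrefl (≡.sym combine-eq) (Fin.combine-monoˡ-< j′ j i′<i)

length≡2 : {A : Set} (xs : List A) → length xs ≡ 2 → ∃[ a ] ∃[ b ] xs ≡ a ∷ b ∷ []
length≡2 (a ∷ b ∷ []) refl = a , b , refl

∈-pair : {A : Set} {x a b : A} → x ∈ a ∷ b ∷ [] → x ≡ a ⊎ x ≡ b
∈-pair (here x≡a)         = inj₁ x≡a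
∈-pair (there (here x≡b)) = inj₂ x≡b

module _ {k n : ℕ} (G : Subgraph k n) where

  Adj-sym : {x y : Vertex k n} → Adj G x y → Adj G y x
  Adj-sym {x} {y} x~y = trans (sym G y x) x~y

  adjacency : Vertex k n → Vertex k n → ℕ
  adjacency x y = 𝟙 (adj G x y ≟ᵇ true)

  adjacency-sym : ∀ x y → adjacency x y ≡ adjacency y x
  adjacency-sym x y = cong (λ e → 𝟙 (e ≟ᵇ true)) (sym G x y)

  adjacency-edge : {x y : Vertex k n} → Adj G x y → adjacency x y ≡ 1
  adjacency-edge x~y = cong (λ e → 𝟙 (e ≟ᵇ true)) x~y

  degree≡∑adjacency : ∀ x → degree G x ≡ ∑[ y ∈ vertices k n ] adjacency x y
  degree≡∑adjacency x = length-filter (λ y → adj G x y ≟ᵇ true) (vertices k n)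

  forward : Vertex k n → Vertex k n → ℕ
  forward x y = 𝟙 ((adj G x y ∧ ⌊ index x <? index y ⌋) ≟ᵇ true)

  edgeCount≡∑forward : edgeCount G ≡ ∑[ x ∈ vertices k n ] ∑[ y ∈ vertices k n ] forward x y
  edgeCount≡∑forward =
    trans (length-filter (λ p → (adj G (proj₁ p) (proj₂ p) ∧ ⌊ index (proj₁ p) <? index (proj₂ p) ⌋) ≟ᵇ true)
                         (cartesianProduct (vertices k n) (vertices k n)))
          (∑-cartesianProduct (vertices k n) (vertices k n) _)

  adjacency≡forward+backward : ∀ x y → adjacency x y ≡ forward x y + forward y x
  adjacency≡forward+backward x y rewrite sym G y x
    with adj G x y in x~y | index x <? index y | index y <? index x
  ... | false | _       | _       = refl
  ... | true  | yes x<y | yes y<x = ⊥-elim (<-asym x<y y<x)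
  ... | true  | yes _   | no _    = refl
  ... | true  | no _    | yes _   = refl
  ... | true  | no x≮y  | no y≮x  =
    ⊥-elim (DiffPart⇒index≢ (inHost G x y x~y) (≤-antisym (≮⇒≥ y≮x) (≮⇒≥ x≮y)))

  ∑-degree : ∑[ x ∈ vertices k n ] degree G x ≡ 2 * edgeCount G
  ∑-degree = begin
    ∑[ x ∈ V ] degree G x                                       ≡⟨ ∑-cong V degree≡∑adjacency ⟩
    ∑[ x ∈ V ] ∑[ y ∈ V ] adjacency x y                         ≡⟨ ∑-cong V (λ x → ∑-cong V (adjacency≡forward+backward x)) ⟩
    ∑[ x ∈ V ] ∑[ y ∈ V ] (forward x y + forward y x)           ≡⟨ ∑-cong V (λ x → ∑-+ V _ _) ⟩
    ∑[ x ∈ V ] (∑[ y ∈ V ] forward x y + ∑[ y ∈ V ] forward y x) ≡⟨ ∑-+ V _ _ ⟩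
    E + ∑[ x ∈ V ] ∑[ y ∈ V ] forward y x                       ≡⟨ cong (E +_) (∑-comm V V (λ x y → forward y x)) ⟩
    E + E                                                       ≡⟨ cong (λ e → e + e) (≡.sym edgeCount≡∑forward) ⟩
    edgeCount G + edgeCount G                                   ≡⟨ cong (edgeCount G +_) (≡.sym (+-identityʳ _)) ⟩
    2 * edgeCount G                                             ∎
    where
    open ≡-Reasoning
    V = vertices k n
    E = ∑[ x ∈ V ] ∑[ y ∈ V ] forward x y

  neighbours : Vertex k n → List (Vertex k n)
  neighbours v = filter (λ u → adj G v u ≟ᵇ true) (vertices k n)

  degree-two : {v : Vertex k n} → degree G v ≡ 2 →
               ∃[ a ] ∃[ b ] (a ≢ b × Adj G v a × Adj G v b × (∀ {x} → Adj G v x → x ≡ a ⊎ x ≡ b))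
  degree-two {v} deg with length≡2 (neighbours v) deg
  ... | a , b , N≡ab = a , b , a≢b , ∈N⇒Adj (here refl) , ∈N⇒Adj (there (here refl)) , Adj⇒a⊎b
    where
    ∈N⇒Adj : ∀ {x} → x ∈ a ∷ b ∷ [] → Adj G v x
    ∈N⇒Adj x∈ab = proj₂ (∈-filter⁻ (λ u → adj G v u ≟ᵇ true) {xs = vertices k n} (subst (_ ∈_) (≡.sym N≡ab) x∈ab))
    Adj⇒a⊎b : ∀ {x} → Adj G v x → x ≡ a ⊎ x ≡ b
    Adj⇒a⊎b {x} v~x = ∈-pair (subst (x ∈_) N≡ab (∈-filter⁺ (λ u → adj G v u ≟ᵇ true) (∈-vertices x) v~x))
    a≢b : a ≢ b
    a≢b with subst Unique N≡ab (filter⁺ (λ u → adj G v u ≟ᵇ true) vertices-unique)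
    ... | (a≢b ∷ []) ∷ _ = a≢b

module _ {k n : ℕ} (G : Subgraph k n) where

  private
    V = Vertex k n

    IsEdge : V → V → V → V → Set
    IsEdge u w p q = (p ≡ u × q ≡ w) ⊎ (p ≡ w × q ≡ u)

    first-end : {u w p q : V} → IsEdge u w p q → p ≡ u ⊎ p ≡ w
    first-end (inj₁ (p≡u , _)) = inj₁ p≡u
    first-end (inj₂ (p≡w , _)) = inj₂ p≡w

    second-end : {u w p q : V} → IsEdge u w p q → q ≡ u ⊎ q ≡ w
    second-end (inj₁ (_ , q≡w)) = inj₂ q≡w
    second-end (inj₂ (_ , q≡u)) = inj₁ q≡u

    Away : V → V → V → Set
    Away p q z = z ≢ p × z ≢ q

    away : {u w p q z : V} → IsEdge u w p q → Away p q z → z ≡ u ⊎ z ≡ w → ⊥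
    away (inj₁ (refl , refl)) (z≢p , _)   (inj₁ refl) = z≢p refl
    away (inj₁ (refl , refl)) (_   , z≢q) (inj₂ refl) = z≢q refl
    away (inj₂ (refl , refl)) (_   , z≢q) (inj₁ refl) = z≢q refl
    away (inj₂ (refl , refl)) (z≢p , _)   (inj₂ refl) = z≢p refl

    old-edge : {u w p q r s : V} → IsEdge u w p q → AdjPlus G u w r s →
               Away p q r ⊎ Away p q s → Adj G r s
    old-edge pq (inj₁ r~s) _ = r~s
    old-edge pq (inj₂ rs) (inj₁ r-away) = ⊥-elim (away pq r-away (first-end rs))
    old-edge pq (inj₂ rs) (inj₂ s-away) = ⊥-elim (away pq s-away (second-end rs))

  Path₃ : V → V → Set
  Path₃ w u = ∃[ y ] ∃[ z ] (Adj G w y × Adj G y z × Adj G z u × y ≢ u × y ≢ z)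

  private
    path-around : {u w p q r s : V} → IsEdge u w p q → Away p q r → Away p q s → r ≢ s →
                  AdjPlus G u w q r → AdjPlus G u w r s → AdjPlus G u w s p → Path₃ w u
    path-around pq@(inj₁ (refl , refl)) r-away s-away r≢s q~r r~s s~p =
      _ , _ , old-edge pq q~r (inj₂ r-away) , old-edge pq r~s (inj₁ r-away) , old-edge pq s~p (inj₁ s-away) ,
      proj₁ r-away , r≢s
    path-around pq@(inj₂ (refl , refl)) r-away s-away r≢s q~r r~s s~p =
      _ , _ , Adj-sym G (old-edge pq s~p (inj₁ s-away)) , Adj-sym G (old-edge pq r~s (inj₁ r-away)) ,
      Adj-sym G (old-edge pq q~r (inj₂ r-away)) , proj₂ s-away , ≢-sym r≢s

  -- A 4-cycle of G + uw must use uw; rotating it to start with uw reduces to path-around.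
  saturation-path : {u w : V} → ¬ HasC4 (Adj G) → HasC4 (AdjPlus G u w) → Path₃ w u
  saturation-path free (p , q , r , s , distinct , inj₁ p~q , inj₁ q~r , inj₁ r~s , inj₁ s~p) =
    ⊥-elim (free (p , q , r , s , distinct , p~q , q~r , r~s , s~p))
  saturation-path free (_ , _ , _ , _ , (p≢q , p≢r , p≢s , q≢r , q≢s , r≢s) , inj₂ pq , q~r , r~s , s~p) =
    path-around pq (≢-sym p≢r , ≢-sym q≢r) (≢-sym p≢s , ≢-sym q≢s) r≢s q~r r~s s~p
  saturation-path free (_ , _ , _ , _ , (p≢q , p≢r , p≢s , q≢r , q≢s , r≢s) , p~q@(inj₁ _) , inj₂ qr , r~s , s~p) =
    path-around qr (≢-sym q≢s , ≢-sym r≢s) (p≢q , p≢r) (≢-sym p≢s) r~s s~p p~q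
  saturation-path free (_ , _ , _ , _ , (p≢q , p≢r , p≢s , q≢r , q≢s , r≢s) , p~q@(inj₁ _) , q~r@(inj₁ _) , inj₂ rs , s~p) =
    path-around rs (p≢r , p≢s) (q≢r , q≢s) p≢q s~p p~q q~r
  saturation-path free (_ , _ , _ , _ , (p≢q , p≢r , p≢s , q≢r , q≢s , r≢s) , p~q@(inj₁ _) , q~r@(inj₁ _) , r~s@(inj₁ _) , inj₂ sp) =
    path-around sp (q≢s , ≢-sym p≢q) (r≢s , ≢-sym p≢r) q≢r p~q q~r r~s

share : ℕ → ℕ → ℕ
share zero    zero    = 1
share zero    (suc _) = 0
share (suc _) zero    = 2
share (suc l) (suc m) = share l m

share-split : ∀ l m → share l m + share m l ≡ 2
share-split zero    zero    = refl
share-split zero    (suc m) = refl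
share-split (suc l) zero    = refl
share-split (suc l) (suc m) = share-split l m

share-pos : ∀ {l m} → m ≤ l → 1 ≤ share l m
share-pos {zero}  z≤n       = s≤s z≤n
share-pos {suc l} z≤n       = s≤s z≤n
share-pos         (s≤s m≤l) = share-pos m≤l

module Discharging {k n : ℕ} (G : Subgraph k n)
  (C4-free : ¬ HasC4 (Adj G))
  (saturated : ∀ u w → DiffPart u w → ¬ Adj G u w → HasC4 (AdjPlus G u w))
  (min-degree : ∀ x → 2 ≤ degree G x)
  {v a b : Vertex k n} (a≢b : a ≢ b) (v~a : Adj G v a) (v~b : Adj G v b) (a≁b : ¬ Adj G a b)
  (N[v] : ∀ {x} → Adj G v x → x ≡ a ⊎ x ≡ b)
  where

  private
    V = vertices k n

  Centre : Vertex k n → Set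
  Centre x = x ≡ v ⊎ x ≡ a ⊎ x ≡ b

  Touches : Vertex k n → Set
  Touches x = Adj G x a ⊎ Adj G x b

  centre? : ∀ x → Dec (Centre x)
  centre? x = x ≟ᵥ v ⊎-dec x ≟ᵥ a ⊎-dec x ≟ᵥ b

  touches? : ∀ x → Dec (Touches x)
  touches? x = adj G x a ≟ᵇ true ⊎-dec adj G x b ≟ᵇ true

  level : Vertex k n → ℕ
  level x with centre? x | touches? x
  ... | yes _ | _     = 0
  ... | no _  | yes _ = 1
  ... | no _  | no _  = 2

  level-centre : ∀ {x} → Centre x → level x ≡ 0
  level-centre {x} centre with centre? x
  ... | yes _      = refl
  ... | no ¬centre = ⊥-elim (¬centre centre)

  level-touching : ∀ {x} → ¬ Centre x → Touches x → level x ≡ 1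
  level-touching {x} ¬centre touches with centre? x | touches? x
  ... | yes centre | _           = ⊥-elim (¬centre centre)
  ... | no _       | yes _       = refl
  ... | no _       | no ¬touches = ⊥-elim (¬touches touches)

  level-far : ∀ {x} → ¬ Centre x → ¬ Touches x → level x ≡ 2
  level-far {x} ¬centre ¬touches with centre? x | touches? x
  ... | yes centre | _           = ⊥-elim (¬centre centre)
  ... | no _       | yes touches = ⊥-elim (¬touches touches)
  ... | no _       | no _        = refl

  level≤2 : ∀ x → level x ≤ 2
  level≤2 x with centre? x | touches? x
  ... | yes _ | _     = z≤n
  ... | no _  | yes _ = s≤s z≤n
  ... | no _  | no _  = ≤-refl

  charge : Vertex k n → ℕ
  charge x = ∑[ y ∈ V ] (adjacency G x y * share (level x) (level y))

  budget : Vertex k n → ℕ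
  budget x = 2 * 𝟙 (x ≟ᵥ a) + 2 * 𝟙 (x ≟ᵥ b) + 𝟙 (proj₁ x Fin.≟ proj₁ v)

  ∑-charge : ∑ V charge ≡ 2 * edgeCount G
  ∑-charge = begin
    ∑ V charge                              ≡⟨ ∑-share V (adjacency G) (λ x y → share (level x) (level y))
                                                 (adjacency-sym G) (λ x y → share-split (level x) (level y)) ⟩
    ∑[ x ∈ V ] ∑[ y ∈ V ] adjacency G x y   ≡⟨ ∑-cong V (λ x → ≡.sym (degree≡∑adjacency G x)) ⟩
    ∑ V (degree G)                          ≡⟨ ∑-degree G ⟩
    2 * edgeCount G                         ∎
    where open ≡-Reasoning

  ∑-budget : ∑ V budget ≡ 4 + n
  ∑-budget = begin
    ∑ V budget                                       ≡⟨ ∑-+ V _ _ ⟩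
    ∑[ x ∈ V ] (2 * 𝟙 (x ≟ᵥ a) + 2 * 𝟙 (x ≟ᵥ b)) + ∑[ x ∈ V ] 𝟙 (proj₁ x Fin.≟ proj₁ v)
                                                     ≡⟨ cong₂ _+_ (∑-+ V _ _) (part-size (proj₁ v)) ⟩
    twice a + twice b + n                            ≡⟨ cong₂ (λ p q → p + q + n) (twice≡2 a) (twice≡2 b) ⟩
    4 + n                                            ∎
    where
    open ≡-Reasoning
    twice : Vertex k n → ℕ
    twice t = ∑[ x ∈ V ] (2 * 𝟙 (x ≟ᵥ t))
    twice≡2 : ∀ t → twice t ≡ 2
    twice≡2 t = trans (≡.sym (*-distribˡ-∑ 2 V _)) (cong (2 *_) (∑-𝟙-unique _≟ᵥ_ vertices-unique (∈-vertices t)))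

  budget-part : ∀ {x} → proj₁ x ≡ proj₁ v → 1 ≤ budget x
  budget-part {x} same = subst (_≤ budget x) (𝟙-yes (proj₁ x Fin.≟ proj₁ v) same) (m≤n+m _ _)

  budget-a : 2 ≤ budget a
  budget-a = subst (λ c → 2 * c ≤ budget a) (𝟙-yes (a ≟ᵥ a) refl) (≤-trans (m≤m+n (2 * 𝟙 (a ≟ᵥ a)) _) (m≤m+n _ _))

  budget-b : 2 ≤ budget b
  budget-b = subst (λ c → 2 * c ≤ budget b) (𝟙-yes (b ≟ᵥ b) refl) (≤-trans (m≤n+m (2 * 𝟙 (b ≟ᵥ b)) (2 * 𝟙 (b ≟ᵥ a))) (m≤m+n _ _))

  private
    edge-term : ∀ {x y} s → Adj G x y → adjacency G x y * s ≡ s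
    edge-term s x~y = trans (cong (_* s) (adjacency-edge G x~y)) (*-identityˡ s)

  share≤charge : ∀ {x y l m} → Adj G x y → level x ≡ l → level y ≡ m → share l m ≤ charge x
  share≤charge {x} {y} x~y refl refl = subst (_≤ charge x) (edge-term _ x~y) (term≤∑ _ (∈-vertices y))

  two-shares≤charge : ∀ {x y z l m m′} → y ≢ z → Adj G x y → Adj G x z →
                      level x ≡ l → level y ≡ m → level z ≡ m′ → share l m + share l m′ ≤ charge x
  two-shares≤charge {x} {y} {z} y≢z x~y x~z refl refl refl =
    subst (_≤ charge x) (cong₂ _+_ (edge-term _ x~y) (edge-term _ x~z)) (two-terms≤∑ _ y≢z (∈-vertices y) (∈-vertices z))

  private
    adjacency≤term : ∀ {x} → level x ≡ 2 → ∀ y → adjacency G x y ≤ adjacency G x y * share (level x) (level y)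
    adjacency≤term {x} lx y = subst (_≤ adjacency G x y * share (level x) (level y)) (*-identityʳ (adjacency G x y))
      (*-monoʳ-≤ (adjacency G x y) (subst (λ l → 1 ≤ share l (level y)) (≡.sym lx) (share-pos (level≤2 y))))

  degree≤charge : ∀ {x} → level x ≡ 2 → degree G x ≤ charge x
  degree≤charge {x} lx = subst (_≤ charge x) (≡.sym (degree≡∑adjacency G x)) (∑-mono V (adjacency≤term lx))

  degree<charge : ∀ {x y} → level x ≡ 2 → Adj G x y → level y ≡ 1 → degree G x + 1 ≤ charge x
  degree<charge {x} {y} lx x~y ly =
    subst (_≤ charge x) (cong (_+ 1) (≡.sym (degree≡∑adjacency G x))) (∑-mono-+ 1 (∈-vertices y) (adjacency≤term lx) at-y)
    where
    at-y : adjacency G x y + 1 ≤ adjacency G x y * share (level x) (level y)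
    at-y = ≤-reflexive (trans (cong (_+ 1) (adjacency-edge G x~y)) (≡.sym (trans (edge-term _ x~y) (cong₂ share lx ly))))

  level-≢ : ∀ {y z} → level y ≢ level z → y ≢ z
  level-≢ ne refl = ne refl

  ¬Centre : ∀ {x} → x ≢ v → x ≢ a → x ≢ b → ¬ Centre x
  ¬Centre x≢v _ _ (inj₁ x≡v)          = x≢v x≡v
  ¬Centre _ x≢a _ (inj₂ (inj₁ x≡a))   = x≢a x≡a
  ¬Centre _ _ x≢b (inj₂ (inj₂ x≡b))   = x≢b x≡b

  touched : ∀ {x} → Touches x → ∃[ w ] (Adj G x w × level w ≡ 0)
  touched (inj₁ x~a) = a , x~a , level-centre (inj₂ (inj₁ refl))
  touched (inj₂ x~b) = b , x~b , level-centre (inj₂ (inj₂ refl))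

  -- Saturation at the non-edge vx yields a path x y z v; as z ∈ {a, b} and a ≁ b, y is
  -- a level-1 vertex.
  outer-neighbour : ∀ {x} → DiffPart v x → ¬ Centre x → ∃[ y ] (Adj G x y × level y ≡ 1)
  outer-neighbour {x} v≉x ¬centre = neighbour (saturation-path G C4-free (saturated v x v≉x v≁x))
    where
    v≁x : ¬ Adj G v x
    v≁x v~x = ¬centre (inj₂ (N[v] v~x))
    neighbour : Path₃ G x v → ∃[ y ] (Adj G x y × level y ≡ 1)
    neighbour (y , z , x~y , y~z , z~v , y≢v , y≢z) with N[v] (Adj-sym G z~v)
    ... | inj₁ refl = y , x~y , level-touching (¬Centre y≢v y≢z (λ { refl → a≁b (Adj-sym G y~z) })) (inj₁ y~z)
    ... | inj₂ refl = y , x~y , level-touching (¬Centre y≢v (λ { refl → a≁b y~z }) y≢z) (inj₂ y~z)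

  3≤charge+budget-outer : ∀ {x} → ¬ Centre x → Dec (Touches x) → Dec (proj₁ x ≡ proj₁ v) → 3 ≤ charge x + budget x
  3≤charge+budget-outer ¬centre (yes touches) (yes same) with touched touches
  ... | w , x~w , lw = +-mono-≤ (share≤charge x~w (level-touching ¬centre touches) lw) (budget-part same)
  3≤charge+budget-outer ¬centre (yes touches) (no diff) with touched touches | outer-neighbour (≢-sym diff) ¬centre
  ... | w , x~w , lw | y , x~y , ly =
    ≤-trans (two-shares≤charge w≢y x~w x~y (level-touching ¬centre touches) lw ly) (m≤m+n _ _)
    where w≢y = level-≢ (λ lw≡ly → 0≢1+n (trans (≡.sym lw) (trans lw≡ly ly)))
  3≤charge+budget-outer {x} ¬centre (no ¬touches) (yes same) =
    +-mono-≤ (≤-trans (min-degree x) (degree≤charge (level-far ¬centre ¬touches))) (budget-part same)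
  3≤charge+budget-outer {x} ¬centre (no ¬touches) (no diff) with outer-neighbour (≢-sym diff) ¬centre
  ... | y , x~y , ly =
    ≤-trans (≤-trans (+-monoˡ-≤ 1 (min-degree x)) (degree<charge (level-far ¬centre ¬touches) x~y ly)) (m≤m+n _ _)

  3≤charge+budget-centre : ∀ {x} → Centre x → 3 ≤ charge x + budget x
  3≤charge+budget-centre (inj₁ refl) =
    +-mono-≤ (two-shares≤charge a≢b v~a v~b (level-centre (inj₁ refl)) (level-centre (inj₂ (inj₁ refl)))
                                            (level-centre (inj₂ (inj₂ refl))))
             (budget-part refl)
  3≤charge+budget-centre (inj₂ (inj₁ refl)) =
    +-mono-≤ (share≤charge (Adj-sym G v~a) (level-centre (inj₂ (inj₁ refl))) (level-centre (inj₁ refl))) budget-a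
  3≤charge+budget-centre (inj₂ (inj₂ refl)) =
    +-mono-≤ (share≤charge (Adj-sym G v~b) (level-centre (inj₂ (inj₂ refl))) (level-centre (inj₁ refl))) budget-b

  3≤charge+budget : ∀ x → 3 ≤ charge x + budget x
  3≤charge+budget x = by-cases (centre? x)
    where
    by-cases : Dec (Centre x) → 3 ≤ charge x + budget x
    by-cases (yes centre) = 3≤charge+budget-centre centre
    by-cases (no ¬centre) = 3≤charge+budget-outer ¬centre (touches? x) (proj₁ x Fin.≟ proj₁ v)

  3kn≤2e+4+n : 3 * k * n ≤ 2 * edgeCount G + 4 + n
  3kn≤2e+4+n = begin
    3 * k * n                         ≡⟨ trans (*-assoc 3 k n) (trans (*-comm 3 (k * n)) (*-assoc k n 3)) ⟩
    k * (n * 3)                       ≡⟨ ≡.sym (∑-vertices-const {k} {n} 3) ⟩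
    ∑[ _ ∈ V ] 3                      ≤⟨ ∑-mono V 3≤charge+budget ⟩
    ∑[ x ∈ V ] (charge x + budget x)  ≡⟨ ∑-+ V charge budget ⟩
    ∑ V charge + ∑ V budget           ≡⟨ cong₂ _+_ ∑-charge ∑-budget ⟩
    2 * edgeCount G + (4 + n)         ≡⟨ ≡.sym (+-assoc _ 4 n) ⟩
    2 * edgeCount G + 4 + n           ∎
    where open ≤-Reasoning

m*n≤e+n⇒[m∸1]*n≤e : ∀ m n e → m * n ≤ e + n → (m ∸ 1) * n ≤ e
m*n≤e+n⇒[m∸1]*n≤e m n e h = begin
  (m ∸ 1) * n   ≡⟨ *-distribʳ-∸ n m 1 ⟩
  m * n ∸ 1 * n ≡⟨ cong (m * n ∸_) (*-identityˡ n) ⟩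
  m * n ∸ n     ≤⟨ ∸-monoˡ-≤ n h ⟩
  e + n ∸ n     ≡⟨ m+n∸n≡m e n ⟩
  e             ∎
  where open ≤-Reasoning

proposition4p10 : (k n : ℕ) → 4 ≤ k → 1 ≤ n → (G : Subgraph k n) →
    C4Saturated G → MinDegree G 2 →
    (∃[ v ] (degree G v ≡ 2 × ¬ InTriangle G v)) →
    (3 * k ∸ 1) * n ≤ 2 * edgeCount G + 4
proposition4p10 k n _ _ G (C4-free , saturated) (_ , min-degree) (v , deg-v , v∉triangle)
  with degree-two G deg-v
... | a , b , a≢b , v~a , v~b , N[v] =
  m*n≤e+n⇒[m∸1]*n≤e (3 * k) n _ (Discharging.3kn≤2e+4+n G C4-free saturated min-degree a≢b v~a v~b a≁b N[v])
  where
  a≁b : ¬ Adj G a b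
  a≁b a~b = v∉triangle (a , b , v~a , a~b , Adj-sym G v~b)
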